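{- Let $r,s:\mathbb{N}\to\mathbb{N}$ satisfy $1\le r(i)<s(i)$ for all $i$, and let $b:\mathbb{N}\to\mathbb{N}\cup\{0\}$ satisfy $b(i)\le i$ and $b(i+1)\le b(i)+1$ for all $i$. Consider the Robin Hood game $RH(r,s,b)$ with Robin playing the strategy $\mathsf{Oldest}_{DET}$. (1) If $i-b(i)$ is bounded, then $\mathsf{Oldest}_{DET}$ is a winning strategy for Robin in $RH(r,s,b)$. (2) If there exist infinitely many $i$ such that $\tilde L(i)\le r(i)$, then $\mathsf{Oldest}_{DET}$ is a winning strategy for Robin in $RH(r,s,b)$.
   Context: The Robin Hood game $RH(r,s,b)$: for each $i\in\mathbb{N}$, on day $i$ the Sheriff puts $s(i)$ new bags (distinctly labelled, no label ever reused) into a cave, and on night $i$ Robin removes $r(i)$ bags from the cave. Robin wins if every bag ever put in the cave is eventually removed. The function $b$ bounds Robin's historical memory: on night $i$ Robin knows, for each bag put in the cave on days $i-b(i)+1,\dots,i$, on which day it was put in, but he cannot distinguish among the bags put in on days $1,\dots,i-b(i)$; the latter bags still in the cave are called very old (Robin can identify which bags are very old). Standing assumption of the paper: $b(i+1)\le b(i)+1$ for all $i$ (equivalently $i-b(i)$ is nondecreasing). Strategy $\mathsf{Oldest}_{DET}$: on night $i$, if there are at least $r(i)$ very old bags, Robin removes any $r(i)$ of them; otherwise he removes all very old bags and then removes bags from the remembered days in order of their day (oldest day first), taking all bags of an earlier day before any bag of a later day, until $r(i)$ bags in total are removed. A strategy is winning if, following it, every bag is (surely) eventually removed. Define $\tilde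 L(i)=\max\{0,\ \sum_{j=1}^{i-b(i)}s(j)-\sum_{j=1}^{i-1}r(j)\}$, the number of bags put in on days $1,\dots,i-b(i)$ and not removed before night $i$. -}

module Defs where

open import Data.Nat using (ℕ; zero; suc; _+_; _∸_; _≤_; _<_; _≤?_)
import Data.Nat as ℕ
open import Data.Bool using (Bool; not)
open import Data.Product using (_×_; _,_; proj₁)
open import Data.Product.Properties using (≡-dec)
open import Data.List using (List; map; upTo; concatMap; filter; filterᵇ; length)
open import Data.Bool.ListAction using (any)
open import Data.List.Membership.Propositional using (_∈_)
open import Data.List.Membership.DecPropositional (≡-dec ℕ._≟_ ℕ._≟_) using (_∈?_)
open import Data.List.Relation.Unary.Unique.Propositional using (Unique)
open import Relation.Nullary using (does)

-- Days are numbered 1, 2, 3, ...; values of r, s, b at 0 are never used.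

-- A bag is identified by (d , k): the k-th bag (0 ≤ k < s d) put in on day d.
Bag : Set
Bag = ℕ × ℕ

day : Bag → ℕ
day = proj₁

sumTo : (ℕ → ℕ) → ℕ → ℕ
sumTo f zero    = 0
sumTo f (suc n) = sumTo f n + f (suc n)

days : ℕ → List ℕ
days n = map suc (upTo n)

bagsUpTo : (s : ℕ → ℕ) → ℕ → List Bag
bagsUpTo s n = concatMap (λ d → map (λ k → (d , k)) (upTo (s d))) (days n)

-- A play records, for each night j, the list of bags Robin removes on night j.
Play : Set
Play = ℕ → List Bag

removedBefore : Play → ℕ → Bag → Bool
removedBefore R i x = any (λ j → does (x ∈? R j)) (days (i ∸ 1))

cave : (s : ℕ → ℕ) → Play → ℕ → List Bag
cave s R i = filterᵇ (λ x → not (removedBefore R i x)) (bagsUpTo s i)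

veryOld : (s b : ℕ → ℕ) → Play → ℕ → List Bag
veryOld s b R i = filter (λ x → day x ≤? i ∸ b i) (cave s R i)

OldestNight : (r s b : ℕ → ℕ) → Play → ℕ → Set
OldestNight r s b R i =
  Unique (R i) ×
  (∀ x → x ∈ R i → x ∈ cave s R i) ×
  length (R i) ≡ r i ×
  (r i ≤ length (veryOld s b R i) → ∀ x → x ∈ R i → x ∈ veryOld s b R i) ×
  -- fewer: remove all very old bags, then the remembered bags oldest day first
  (length (veryOld s b R i) < r i →
     (∀ x → x ∈ veryOld s b R i → x ∈ R i) ×
     (∀ x y → x ∈ R i → y ∈ cave s R i → day y < day x → y ∈ R i))
  where open import Relation.Binary.PropositionalEquality using (_≡_)

FollowsOldest : (r s b : ℕ → ℕ) → Play → Set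
FollowsOldest r s b R = ∀ i → 1 ≤ i → OldestNight r s b R i

AllRemoved : (s : ℕ → ℕ) → Play → Set
AllRemoved s R = ∀ d k → 1 ≤ d → k < s d → Σ ℕ (λ j → 1 ≤ j × (d , k) ∈ R j)
  where open import Data.Product using (Σ)

OldestWinning : (r s b : ℕ → ℕ) → Set
OldestWinning r s b = ∀ (R : Play) → FollowsOldest r s b R → AllRemoved s R

-- L̃(i) = max{0, Σ_{j=1}^{i-b(i)} s j − Σ_{j=1}^{i-1} r j}  (truncated subtraction)
Ltilde : (r s b : ℕ → ℕ) → ℕ → ℕ
Ltilde r s b i = sumTo s (i ∸ b i) ∸ sumTo r (i ∸ 1)

{-# OPTIONS --safe #-}
-- Suppose the bag x, put in on day d, is still in the cave after night i. A bag y
-- removed on a night j ≤ i with day y > d was not taken oldest-day-first (x would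
-- have gone before it), so it was very old: day y ≤ j ∸ b j ≤ i ∸ b i, as i ∸ b i is
-- nondecreasing. Hence x and the Σ_{j ≤ i} r j bags removed so far are distinct bags
-- from days ≤ max (d , i ∸ b i), so Σ_{j ≤ i} r j < Σ_{j ≤ max (d , i ∸ b i)} s j.
-- This fails once L̃ i ≤ r i (i.e. Σ_{j ≤ i ∸ b i} s j ≤ Σ_{j ≤ i} r j) and
-- i > Σ_{j ≤ d} s j, because r ≥ 1 gives i ≤ Σ_{j ≤ i} r j. Part (1) reduces to
-- part (2): if i ∸ b i ≤ C always, then L̃ i = 0 for every i > Σ_{j ≤ C} s j.
module Submission where

open import Defs
open import Data.Nat using (ℕ; zero; suc; _+_; _∸_; _⊔_; _≤_; _<_; _≤′_; _≤?_; _≟_; z≤n; s≤s; ≤′-refl; ≤′-step)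
open import Data.Nat.Properties
open import Data.Bool using (true; false; not; T)
open import Function using (_∘_)
open import Data.Unit using (tt)
open import Data.Bool.ListAction using (any)
open import Data.Product using (Σ; ∃-syntax; _×_; _,_; proj₁; proj₂)
open import Data.Product.Properties using (≡-dec)
open import Data.List using (List; []; _∷_; _++_; [_]; map; upTo; concatMap; length)
open import Data.List.Properties using (length-++; length-map; length-upTo; map-++; concatMap-++; ++-identityʳ; upTo-∷ʳ)
open import Data.List.Membership.Propositional using (_∈_; _∉_; find; lose)
open import Data.List.Membership.Propositional.Properties using (∈-map⁺; ∈-map⁻; ∈-upTo⁺; ∈-upTo⁻; ∈-concatMap⁺; ∈-concatMap⁻; ∈-filter⁺; ∈-filter⁻)
open import Data.List.Membership.DecPropositional (≡-dec _≟_ _≟_) using (_∈?_)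
open import Data.List.Relation.Binary.Subset.Propositional using (_⊆_)
open import Data.List.Relation.Unary.Any using (here; there)
import Data.List.Relation.Unary.Any as Any
import Data.List.Relation.Unary.Any.Properties as Any
import Data.List.Relation.Unary.All as All
open import Data.List.Relation.Unary.All.Properties using (¬Any⇒All¬)
open import Data.List.Relation.Unary.AllPairs using ([]; _∷_)
open import Data.List.Relation.Unary.Unique.Propositional using (Unique)
import Data.List.Relation.Unary.Unique.Propositional.Properties as Unique
open import Relation.Nullary using (¬_; yes; no; does; contradiction)
open import Relation.Nullary.Decidable using (Dec; T?)
open import Relation.Binary.PropositionalEquality using (_≡_; _≢_; refl; sym; trans; cong; cong₂; subst; subst₂; module ≡-Reasoning)

module _ {A : Set} where

  remove-∈ : ∀ {x : A} {ys} → x ∈ ys →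
             ∃[ zs ] (length ys ≡ suc (length zs) × (∀ {w} → w ∈ ys → w ≢ x → w ∈ zs))
  remove-∈ {ys = _ ∷ ys} (here refl) =
    ys , refl , λ { (here refl) w≢x → contradiction refl w≢x ; (there w∈) _ → w∈ }
  remove-∈ {ys = y ∷ _} (there x∈) with zs , eq , keep ← remove-∈ x∈ =
    y ∷ zs , cong suc eq , λ { (here refl) _ → here refl ; (there w∈) w≢x → there (keep w∈ w≢x) }

  Unique-⊆⇒length≤ : ∀ {xs ys : List A} → Unique xs → xs ⊆ ys → length xs ≤ length ys
  Unique-⊆⇒length≤ {[]} _ _ = z≤n
  Unique-⊆⇒length≤ {x ∷ xs} (x∉xs ∷ unique) xs⊆ys with zs , eq , keep ← remove-∈ (xs⊆ys (here refl)) =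
    subst (suc (length xs) ≤_) (sym eq) (s≤s (Unique-⊆⇒length≤ unique xs⊆zs))
    where
    xs⊆zs : xs ⊆ zs
    xs⊆zs w∈ = keep (xs⊆ys (there w∈)) (λ w≡x → All.lookup x∉xs w∈ (sym w≡x))

T-not⁻ : ∀ {b} → T (not b) → ¬ T b
T-not⁻ {true} ()
T-not⁻ {false} _ ()

T-not⁺ : ∀ {b} → ¬ T b → T (not b)
T-not⁺ {true} ¬t = ¬t tt
T-not⁺ {false} _ = tt

T-does⁻ : ∀ {P : Set} (p? : Dec P) → T (does p?) → P
T-does⁻ (yes p) _ = p

T-does⁺ : ∀ {P : Set} (p? : Dec P) → P → T (does p?)
T-does⁺ (yes _) _ = tt
T-does⁺ (no ¬p) p = ¬p p

sumTo-mono : ∀ f {m n} → m ≤ n → sumTo f m ≤ sumTo f n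
sumTo-mono f m≤n = go (≤⇒≤′ m≤n)
  where
  go : ∀ {m n} → m ≤′ n → sumTo f m ≤ sumTo f n
  go ≤′-refl = ≤-refl
  go (≤′-step m≤′n) = ≤-trans (go m≤′n) (m≤m+n _ _)

n≤sumTo : ∀ {f} → (∀ i → 1 ≤ i → 1 ≤ f i) → ∀ n → n ≤ sumTo f n
n≤sumTo f≥1 zero = z≤n
n≤sumTo f≥1 (suc n) =
  ≤-trans (≤-reflexive (+-comm 1 n)) (+-mono-≤ (n≤sumTo f≥1 n) (f≥1 (suc n) (s≤s z≤n)))

j∸b[j]≤i∸b[i] : ∀ (b : ℕ → ℕ) → (∀ i → 1 ≤ i → b (i + 1) ≤ b i + 1) →
              ∀ {j i} → 1 ≤ j → j ≤ i → j ∸ b j ≤ i ∸ b i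
j∸b[j]≤i∸b[i] b b-step 1≤j j≤i = go 1≤j (≤⇒≤′ j≤i)
  where
  go : ∀ {j i} → 1 ≤ j → j ≤′ i → j ∸ b j ≤ i ∸ b i
  go _ ≤′-refl = ≤-refl
  go {j} {suc i} 1≤j (≤′-step j≤′i) = ≤-trans (go 1≤j j≤′i) (∸-monoʳ-≤ (suc i) b[1+i]≤1+b[i])
    where
    b[1+i]≤1+b[i] : b (suc i) ≤ suc (b i)
    b[1+i]≤1+b[i] = subst₂ (λ u v → b u ≤ v) (+-comm i 1) (+-comm (b i) 1)
                      (b-step i (≤-trans 1≤j (≤′⇒≤ j≤′i)))

∈-days⁺ : ∀ {n j} → 1 ≤ j → j ≤ n → j ∈ days n
∈-days⁺ {j = suc j} _ j<n = ∈-map⁺ suc (∈-upTo⁺ j<n)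

∈-days⁻ : ∀ {n j} → j ∈ days n → 1 ≤ j × j ≤ n
∈-days⁻ j∈ with _ , i∈ , refl ← ∈-map⁻ suc j∈ = s≤s z≤n , ∈-upTo⁻ i∈

days-suc : ∀ n → days (suc n) ≡ days n ++ [ suc n ]
days-suc n = trans (cong (map suc) (sym (upTo-∷ʳ n))) (map-++ suc (upTo n) [ n ])

module _ {A : Set} (f : ℕ → List A) where

  concatMap-days-suc : ∀ n → concatMap f (days (suc n)) ≡ concatMap f (days n) ++ f (suc n)
  concatMap-days-suc n = begin
    concatMap f (days (suc n))                 ≡⟨ cong (concatMap f) (days-suc n) ⟩
    concatMap f (days n ++ [ suc n ])          ≡⟨ concatMap-++ f (days n) [ suc n ] ⟩
    concatMap f (days n) ++ (f (suc n) ++ [])  ≡⟨ cong (concatMap f (days n) ++_) (++-identityʳ (f (suc n))) ⟩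
    concatMap f (days n) ++ f (suc n)          ∎
    where open ≡-Reasoning

  length-concatMap-days : ∀ {g} → (∀ j → 1 ≤ j → length (f j) ≡ g j) →
                          ∀ n → length (concatMap f (days n)) ≡ sumTo g n
  length-concatMap-days length-f zero = refl
  length-concatMap-days length-f (suc n) = begin
    length (concatMap f (days (suc n)))             ≡⟨ cong length (concatMap-days-suc n) ⟩
    length (concatMap f (days n) ++ f (suc n))      ≡⟨ length-++ (concatMap f (days n)) ⟩
    length (concatMap f (days n)) + length (f (suc n))
      ≡⟨ cong₂ _+_ (length-concatMap-days length-f n) (length-f (suc n) (s≤s z≤n)) ⟩
    _ ∎
    where open ≡-Reasoning

  ∈-concatMap-days⁻ : ∀ {n x} → x ∈ concatMap f (days n) → ∃[ j ] (1 ≤ j × j ≤ n × x ∈ f j)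
  ∈-concatMap-days⁻ x∈ with find (∈-concatMap⁻ f x∈)
  ... | j , j∈ , x∈fj with ∈-days⁻ j∈
  ...   | 1≤j , j≤n = j , 1≤j , j≤n , x∈fj

  ∈-concatMap-days⁺ : ∀ {n j x} → 1 ≤ j → j ≤ n → x ∈ f j → x ∈ concatMap f (days n)
  ∈-concatMap-days⁺ 1≤j j≤n x∈fj = ∈-concatMap⁺ f (lose (∈-days⁺ 1≤j j≤n) x∈fj)

  concatMap-days-mono : ∀ {m n} → m ≤ n → concatMap f (days m) ⊆ concatMap f (days n)
  concatMap-days-mono m≤n x∈ with j , 1≤j , j≤m , x∈fj ← ∈-concatMap-days⁻ x∈ =
    ∈-concatMap-days⁺ 1≤j (≤-trans j≤m m≤n) x∈fj

dayBags : (ℕ → ℕ) → ℕ → List Bag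
dayBags s d = map (d ,_) (upTo (s d))

removedUpTo : Play → ℕ → List Bag
removedUpTo R n = concatMap R (days n)

module _ (s : ℕ → ℕ) where

  length-bagsUpTo : ∀ n → length (bagsUpTo s n) ≡ sumTo s n
  length-bagsUpTo = length-concatMap-days (dayBags s)
    (λ d _ → trans (length-map (d ,_) (upTo (s d))) (length-upTo (s d)))

  ∈-bagsUpTo⁺ : ∀ {n d k} → 1 ≤ d → d ≤ n → k < s d → (d , k) ∈ bagsUpTo s n
  ∈-bagsUpTo⁺ {d = d} 1≤d d≤n k<s = ∈-concatMap-days⁺ (dayBags s) 1≤d d≤n (∈-map⁺ (d ,_) (∈-upTo⁺ k<s))

  ∈-bagsUpTo⁻ : ∀ n {x} → x ∈ bagsUpTo s n → x ∈ bagsUpTo s (day x) × day x ≤ n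
  ∈-bagsUpTo⁻ n x∈ with ∈-concatMap-days⁻ (dayBags s) x∈
  ... | d , 1≤d , d≤n , x∈d with ∈-map⁻ (d ,_) x∈d
  ...   | k , k∈ , refl =
    ∈-bagsUpTo⁺ 1≤d ≤-refl (∈-upTo⁻ k∈) , d≤n

  bagsUpTo-mono : ∀ {m n} → m ≤ n → bagsUpTo s m ⊆ bagsUpTo s n
  bagsUpTo-mono = concatMap-days-mono (dayBags s)

removedBefore⇒∈ : ∀ {R i x} → T (removedBefore R i x) → x ∈ removedUpTo R (i ∸ 1)
removedBefore⇒∈ {R} {i} {x} t =
  ∈-concatMap⁺ R
    (Any.map (λ {j} → T-does⁻ (x ∈? R j)) (Any.any⁻ (λ j → does (x ∈? R j)) (days (i ∸ 1)) t))

∈⇒removedBefore : ∀ {R i x} → x ∈ removedUpTo R (i ∸ 1) → T (removedBefore R i x)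
∈⇒removedBefore {R} {i} {x} x∈ =
  Any.any⁺ (λ j → does (x ∈? R j))
    (Any.map (λ {j} → T-does⁺ (x ∈? R j)) (∈-concatMap⁻ R {xs = days (i ∸ 1)} x∈))

module _ (s : ℕ → ℕ) (R : Play) where

  ∈-cave⁻ : ∀ i {x} → x ∈ cave s R i → x ∈ bagsUpTo s i × x ∉ removedUpTo R (i ∸ 1)
  ∈-cave⁻ i x∈ with ∈-filter⁻ (λ x → T? (not (removedBefore R i x))) {xs = bagsUpTo s i} x∈
  ... | x∈bags , t = x∈bags , T-not⁻ t ∘ ∈⇒removedBefore {R} {i}

  ∈-cave⁺ : ∀ i {x} → x ∈ bagsUpTo s i → x ∉ removedUpTo R (i ∸ 1) → x ∈ cave s R i
  ∈-cave⁺ i x∈bags x∉ = ∈-filter⁺ (λ x → T? (not (removedBefore R i x))) {xs = bagsUpTo s i} x∈bags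
    (T-not⁺ (x∉ ∘ removedBefore⇒∈ {R} {i}))

  stays-in-cave : ∀ {i j x} → x ∈ bagsUpTo s j → x ∉ removedUpTo R i → j ≤ i → x ∈ cave s R j
  stays-in-cave {j = j} x∈bags x∉ j≤i =
    ∈-cave⁺ j x∈bags (x∉ ∘ concatMap-days-mono R (≤-trans (m∸n≤m j 1) j≤i))

Ltilde≤r⇒sumTo≤sumTo : ∀ r s b {i} → 1 ≤ i → Ltilde r s b i ≤ r i → sumTo s (i ∸ b i) ≤ sumTo r i
Ltilde≤r⇒sumTo≤sumTo r s b {suc i} _ L≤r =
  ≤-trans (m≤n+m∸n (sumTo s (suc i ∸ b (suc i))) (sumTo r i)) (+-monoʳ-≤ (sumTo r i) L≤r)

module OldestPlay (r s b : ℕ → ℕ) (R : Play) where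

  removed⇒bag : ∀ {j y} → OldestNight r s b R j → y ∈ R j → y ∈ bagsUpTo s (day y) × day y ≤ j
  removed⇒bag {j} (_ , ⊆cave , _) y∈Rj = ∈-bagsUpTo⁻ s j (proj₁ (∈-cave⁻ s R j (⊆cave _ y∈Rj)))

  younger-removed⇒veryOld : ∀ {j x y} → OldestNight r s b R j →
                            x ∈ cave s R j → x ∉ R j → y ∈ R j → day x < day y → day y ≤ j ∸ b j
  younger-removed⇒veryOld {j} {x} {y} (_ , _ , _ , takes-veryOld , takes-oldest) x∈cave x∉Rj y∈Rj x<y
    with r j ≤? length (veryOld s b R j)
  ... | yes enough =
    proj₂ (∈-filter⁻ (λ z → day z ≤? j ∸ b j) {xs = cave s R j} (takes-veryOld enough y y∈Rj))
  ... | no scarce = contradiction (proj₂ (takes-oldest (≰⇒> scarce)) y x y∈Rj x∈cave x<y) x∉Rj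

  module _ (follows : FollowsOldest r s b R) where

    removedUpTo-Unique : ∀ n → Unique (removedUpTo R n)
    removedUpTo-Unique zero = []
    removedUpTo-Unique (suc n) with unique , ⊆cave , _ ← follows (suc n) (s≤s z≤n) =
      subst Unique (sym (concatMap-days-suc R n))
        (Unique.++⁺ (removedUpTo-Unique n) unique
          (λ (x∈ , x∈R) → proj₂ (∈-cave⁻ s R (suc n) (⊆cave _ x∈R)) x∈))

    length-removedUpTo : ∀ n → length (removedUpTo R n) ≡ sumTo r n
    length-removedUpTo = length-concatMap-days R length-R
      where
      length-R : ∀ j → 1 ≤ j → length (R j) ≡ r j
      length-R j 1≤j with _ , _ , length≡r , _ ← follows j 1≤j = length≡r

    module _ (b-step : ∀ i → 1 ≤ i → b (i + 1) ≤ b i + 1) {i : ℕ} {x : Bag}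
             (x∈bags : x ∈ bagsUpTo s (day x)) (x∉ : x ∉ removedUpTo R i) where

      removed-while-waiting : ∀ {y} → y ∈ removedUpTo R i → day y ≤ day x ⊔ (i ∸ b i)
      removed-while-waiting {y} y∈ with j , 1≤j , j≤i , y∈Rj ← ∈-concatMap-days⁻ R y∈ | day y ≤? day x
      ... | yes y≤x = ≤-trans y≤x (m≤m⊔n _ _)
      ... | no y≰x = ≤-trans y-veryOld (m≤n⊔m _ _)
        where
        x<y : day x < day y
        x<y = ≰⇒> y≰x
        x<j : day x < j
        x<j = <-≤-trans x<y (proj₂ (removed⇒bag (follows j 1≤j) y∈Rj))
        x∈cave : x ∈ cave s R j
        x∈cave = stays-in-cave s R (bagsUpTo-mono s (<⇒≤ x<j) x∈bags) x∉ j≤i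
        y-veryOld : day y ≤ i ∸ b i
        y-veryOld = ≤-trans
          (younger-removed⇒veryOld (follows j 1≤j) x∈cave (x∉ ∘ ∈-concatMap-days⁺ R 1≤j j≤i) y∈Rj x<y)
          (j∸b[j]≤i∸b[i] b b-step 1≤j j≤i)

      waiting∷removed⊆bagsUpTo : x ∷ removedUpTo R i ⊆ bagsUpTo s (day x ⊔ (i ∸ b i))
      waiting∷removed⊆bagsUpTo (here refl) = bagsUpTo-mono s (m≤m⊔n (day x) (i ∸ b i)) x∈bags
      waiting∷removed⊆bagsUpTo (there y∈) with j , 1≤j , _ , y∈Rj ← ∈-concatMap-days⁻ R {i} y∈ =
        bagsUpTo-mono s (removed-while-waiting y∈) (proj₁ (removed⇒bag (follows j 1≤j) y∈Rj))

      sumTo-r<sumTo-s : sumTo r i < sumTo s (day x ⊔ (i ∸ b i))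
      sumTo-r<sumTo-s = begin-strict
        sumTo r i                                ≡⟨ length-removedUpTo i ⟨
        length (removedUpTo R i)                 <⟨ n<1+n _ ⟩
        length (x ∷ removedUpTo R i)             ≤⟨ Unique-⊆⇒length≤ (¬Any⇒All¬ _ x∉ ∷ removedUpTo-Unique i)
                                                                     waiting∷removed⊆bagsUpTo ⟩
        length (bagsUpTo s (day x ⊔ (i ∸ b i)))  ≡⟨ length-bagsUpTo s (day x ⊔ (i ∸ b i)) ⟩
        sumTo s (day x ⊔ (i ∸ b i))              ∎
        where open ≤-Reasoning

oldest-wins-if-Ltilde≤r-infinitely-often : ∀ r s b →
  (∀ i → 1 ≤ i → 1 ≤ r i) → (∀ i → 1 ≤ i → b (i + 1) ≤ b i + 1) →
  (∀ N → Σ ℕ (λ i → N ≤ i × 1 ≤ i × Ltilde r s b i ≤ r i)) → OldestWinning r s b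
oldest-wins-if-Ltilde≤r-infinitely-often r s b r≥1 b-step often R follows d k 1≤d k<s
  with often (suc (sumTo s d))
... | i , d-early , 1≤i , L≤r with (d , k) ∈? removedUpTo R i
...   | yes x∈ with j , 1≤j , _ , x∈Rj ← ∈-concatMap-days⁻ R {i} x∈ = j , 1≤j , x∈Rj
...   | no x∉ =
  contradiction too-few-bags (<⇒≱ (sumTo-r<sumTo-s follows b-step (∈-bagsUpTo⁺ s 1≤d ≤-refl k<s) x∉))
  where
  open OldestPlay r s b R
  open ≤-Reasoning
  too-few-bags : sumTo s (d ⊔ (i ∸ b i)) ≤ sumTo r i
  too-few-bags = begin
    sumTo s (d ⊔ (i ∸ b i))          ≡⟨ mono-≤-distrib-⊔ (sumTo-mono s) d (i ∸ b i) ⟩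
    sumTo s d ⊔ sumTo s (i ∸ b i)    ≤⟨ ⊔-lub (≤-trans (n≤1+n _) (≤-trans d-early (n≤sumTo r≥1 i)))
                                              (Ltilde≤r⇒sumTo≤sumTo r s b 1≤i L≤r) ⟩
    sumTo r i                        ∎

Ltilde≤r-infinitely-often-if-bounded : ∀ r s b → (∀ i → 1 ≤ i → 1 ≤ r i) →
  Σ ℕ (λ C → ∀ i → 1 ≤ i → i ∸ b i ≤ C) →
  ∀ N → Σ ℕ (λ i → N ≤ i × 1 ≤ i × Ltilde r s b i ≤ r i)
Ltilde≤r-infinitely-often-if-bounded r s b r≥1 (C , bounded) N =
  suc n , m≤n⇒m≤1+n (m≤m+n N _) , s≤s z≤n , ≤-trans (≤-reflexive (m≤n⇒m∸n≡0 old≤removed)) z≤n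
  where
  n : ℕ
  n = N + sumTo s C
  old≤removed : sumTo s (suc n ∸ b (suc n)) ≤ sumTo r n
  old≤removed = begin
    sumTo s (suc n ∸ b (suc n))  ≤⟨ sumTo-mono s (bounded (suc n) (s≤s z≤n)) ⟩
    sumTo s C                    ≤⟨ m≤n+m (sumTo s C) N ⟩
    n                            ≤⟨ n≤sumTo r≥1 n ⟩
    sumTo r n                    ∎
    where open ≤-Reasoning

proposition2p2 : (r s b : ℕ → ℕ) →
    (∀ i → 1 ≤ i → 1 ≤ r i) →
    (∀ i → 1 ≤ i → r i < s i) →
    (∀ i → 1 ≤ i → b i ≤ i) →
    (∀ i → 1 ≤ i → b (i + 1) ≤ b i + 1) →
    ((Σ ℕ (λ C → ∀ i → 1 ≤ i → i ∸ b i ≤ C)) → OldestWinning r s b) ×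
    ((∀ N → Σ ℕ (λ i → N ≤ i × 1 ≤ i × Ltilde r s b i ≤ r i)) → OldestWinning r s b)
proposition2p2 r s b r≥1 _ _ b-step =
  oldest-wins-if-Ltilde≤r-infinitely-often r s b r≥1 b-step ∘ Ltilde≤r-infinitely-often-if-bounded r s b r≥1 ,
  oldest-wins-if-Ltilde≤r-infinitely-often r s b r≥1 b-step
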